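{- Let $\tilde H$ be the graph with $V(\tilde H)=\{0,1,2,3,4,5\}$ and $E(\tilde H)=\{xy: x-y\equiv \pm1 \pmod 6\}\cup\{\{0,3\}\}$ (a $6$-cycle with a chord between opposite vertices). Then there is a constant $c>0$ such that for all sufficiently large $n\in\mathbb N$ there exists an $n$-vertex graph $\tilde G$ whose $\tilde H$-process $(\tilde G_i)_{i\geq0}$ satisfies $\tau_{\tilde H}(\tilde G)\geq cn$ and $\tilde G_i$ is bipartite for all $i\geq 0$.
   Context: For graphs $H$ and $G$, let $n_H(G)$ be the number of copies of $H$ in $G$. The $H$-process on a graph $G$ is the sequence $(G_i)_{i\geq0}$ with $G_0=G$, $V(G_i)=V(G)$ and $E(G_i)=E(G_{i-1})\cup\{e\in\binom{V(G)}{2}: n_H(G_{i-1}+e)>n_H(G_{i-1})\}$ for $i\ge1$. The running time is $\tau_H(G)=\min\{t\in\mathbb N: G_t=G_{t+1}\}$. -}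

module Defs where

open import Data.Bool using (Bool; true; false; _∧_; _∨_; not; T)
open import Data.Nat using (ℕ; zero; suc; _+_; _*_; _≤_; _<_; _%_; _/_; _≡ᵇ_; _<ᵇ_)
open import Data.Fin using (Fin; toℕ)
open import Data.Fin.Properties using () renaming (_≟_ to _≟ᶠ_)
open import Data.List using (List; []; _∷_; length; filterᵇ; foldr; concatMap; map; allFin)
open import Data.Product using (Σ; _×_; _,_)
open import Relation.Binary.PropositionalEquality using (_≡_; _≢_)
open import Relation.Nullary.Decidable using (⌊_⌋)

Graph : ℕ → Set
Graph n = Fin n → Fin n → Bool

IsSimple : {n : ℕ} → Graph n → Set
IsSimple {n} G = (∀ x y → G x y ≡ G y x) × (∀ x → G x x ≡ false)

Htilde : Graph 6
Htilde x y =
  (((toℕ x + 1) % 6) ≡ᵇ toℕ y) ∨ (((toℕ y + 1) % 6) ≡ᵇ toℕ x)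
  ∨ ((toℕ x ≡ᵇ 0) ∧ (toℕ y ≡ᵇ 3)) ∨ ((toℕ x ≡ᵇ 3) ∧ (toℕ y ≡ᵇ 0))

allMaps : (k n : ℕ) → List (Fin k → Fin n)
allMaps zero    n = (λ ()) ∷ []
allMaps (suc k) n =
  concatMap (λ f → map (λ v → λ { Fin.zero → v ; (Fin.suc i) → f i }) (allFin n)) (allMaps k n)

allB : {A : Set} → (A → Bool) → List A → Bool
allB p = foldr (λ a b → p a ∧ b) true

isEmbedding : {m n : ℕ} → Graph m → Graph n → (Fin m → Fin n) → Bool
isEmbedding {m} H G φ =
  allB (λ i → allB (λ j →
        (⌊ i ≟ᶠ j ⌋ ∨ not ⌊ φ i ≟ᶠ φ j ⌋) ∧
        (not (H i j) ∨ G (φ i) (φ j)))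
      (allFin m)) (allFin m)

nEmb : {m n : ℕ} → Graph m → Graph n → ℕ
nEmb {m} {n} H G = length (filterᵇ (isEmbedding H G) (allMaps m n))

divOrZero : ℕ → ℕ → ℕ
divOrZero a zero    = 0
divOrZero a (suc d) = a / suc d

-- n_H(G): number of copies of H in G (subgraphs of G isomorphic to H)
--        = #embeddings(H,G) / #automorphisms(H)
nCopies : {m n : ℕ} → Graph m → Graph n → ℕ
nCopies H G = divOrZero (nEmb H G) (nEmb H H)

addEdge : {n : ℕ} → Graph n → Fin n → Fin n → Graph n
addEdge G x y u v = G u v ∨ (⌊ u ≟ᶠ x ⌋ ∧ ⌊ v ≟ᶠ y ⌋) ∨ (⌊ u ≟ᶠ y ⌋ ∧ ⌊ v ≟ᶠ x ⌋)

step : {m n : ℕ} → Graph m → Graph n → Graph n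
step H G x y = G x y ∨ (not ⌊ x ≟ᶠ y ⌋ ∧ (nCopies H G <ᵇ nCopies H (addEdge G x y)))

process : {m n : ℕ} → Graph m → Graph n → ℕ → Graph n
process H G zero    = G
process H G (suc i) = step H (process H G i)

Stable : {m n : ℕ} → Graph m → Graph n → ℕ → Set
Stable H G t = ∀ x y → process H G t x y ≡ process H G (suc t) x y

IsRunningTime : {m n : ℕ} → Graph m → Graph n → ℕ → Set
IsRunningTime H G τ = Stable H G τ × (∀ s → Stable H G s → τ ≤ s)

Bipartite : {n : ℕ} → Graph n → Set
Bipartite {n} G = Σ (Fin n → Bool) λ χ → ∀ x y → G x y ≡ true → χ x ≢ χ y

module Submission where

-- Let T_k be the complete bipartite graph on {0, …, k}, with sides given by parity, with the path k, k+1, k+2, …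
-- attached at k, and take G = T_5 on n vertices.  For k ≥ 4 one step of the H̃-process turns T_k into T_(k+2).
-- No copy of H̃ can use a non-edge xy of T_(k+2): H̃ minus any edge ij still has a cycle within distance two of i
-- and j, the vertices of a cycle of T_k lie in the block since the tail is a path, so x and y lie in {0, …, k+2};
-- an odd path from i to j makes their parities differ.  Conversely every edge xy of T_(k+2) outside T_k completes
-- a copy of H̃: up to a symmetry of the block it is a translate of one of two explicit copies, and composing with
-- the four automorphisms of H̃ gives four new embeddings, that is, one more copy.  Hence G_i = T_(5+2i), which is
-- bipartite, and the process stops once the block covers all n vertices, after ⌈(n-6)/2⌉ steps.

open import Defs
open import Data.Bool using (Bool; true; false; T; not; _∧_; _∨_)
open import Data.Bool.Properties using (T-∧; T-∨; T-≡)
open import Data.Empty using (⊥-elim)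
open import Data.Fin using (Fin; toℕ; fromℕ<)
open import Data.Fin.Patterns using (0F; 1F; 2F; 3F; 4F; 5F)
open import Data.Fin.Properties
  using (any?; all?; injective⇒≤; toℕ-injective; toℕ-fromℕ<; toℕ<n) renaming (_≟_ to _≟ᶠ_)
open import Data.List using (List; []; _∷_; length; filterᵇ; allFin; lookup)
open import Data.List.Extrema.Nat using (argmax; argmax-all; f[⊥]≤f[argmax]; f[xs]≤f[argmax])
open import Data.List.Membership.Propositional using (_∈_)
open import Data.List.Membership.Propositional.Properties using (∈-allFin)
open import Data.List.Properties using (filter-≐)
open import Data.List.Relation.Unary.All using (All; []; _∷_)
import Data.List.Relation.Unary.All as All
open import Data.List.Relation.Unary.All.Properties using (tabulate⁺; tabulate⁻)
open import Data.List.Relation.Unary.Any using (Any; here; index)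
import Data.List.Relation.Unary.Any as Any
open import Data.List.Relation.Unary.Any.Properties using (concatMap⁺; map⁺; lookup-index; lookup-result; filter⁺)
open import Data.Nat using (ℕ; zero; suc; _+_; _*_; _∸_; _/_; ⌈_/2⌉; _≤_; _<_; _≤?_; _<ᵇ_; z≤n; s≤s; NonZero)
open import Data.Nat.Base using (parity)
open import Data.Nat.DivMod using (/-monoˡ-≤; m/n≡1+[m∸n]/n)
import Data.Nat.Properties as ℕ
open import Data.Parity using (Parity; 0ℙ; 1ℙ)
import Data.Parity.Properties as ℙ
open import Data.Product using (Σ; ∃; ∃₂; _×_; _,_; proj₁; proj₂)
import Data.Product as Product
open import Data.Sum using (_⊎_; inj₁; inj₂; [_,_]′)
import Data.Sum as Sum
open import Function using (_∘_; id; flip; case_of_; _⇔_; mk⇔; Equivalence; Injective)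
open import Relation.Binary.Definitions using (DecidableEquality; tri<; tri≈; tri>)
open import Relation.Binary.PropositionalEquality using (_≡_; _≢_; _≗_; refl; sym; trans; cong; cong₂; subst; subst₂)
open import Relation.Nullary using (¬_; Dec; yes; no; ¬?; contradiction)
open import Relation.Nullary.Decidable
  using ( ⌊_⌋; T?; map′; decidable-stable; _×-dec_; _⊎-dec_; _→-dec_; from-yes
        ; toWitness; fromWitness; toWitnessFalse; fromWitnessFalse)

open Equivalence using (to; from)

private variable
  a b c d k m n : ℕ

-- Graphs, embeddings and the H-process

_≐_ : Graph n → Graph n → Set
G ≐ G′ = ∀ x y → G x y ≡ G′ x y

_⊆ᴳ_ : Graph n → Graph n → Set
G ⊆ᴳ G′ = ∀ {x y} → T (G x y) → T (G′ x y)

T-injective : ∀ {p q} → (T p ⇔ T q) → p ≡ q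
T-injective {true}  {true}  _ = refl
T-injective {true}  {false} e = ⊥-elim (to e _)
T-injective {false} {true}  e = ⊥-elim (from e _)
T-injective {false} {false} _ = refl

Joins : {A : Set} → A → A → A → A → Set
Joins x y u v = (u ≡ x × v ≡ y) ⊎ (u ≡ y × v ≡ x)

joins? : {A : Set} → DecidableEquality A → (x y u v : A) → Dec (Joins x y u v)
joins? _≟_ x y u v = (u ≟ x ×-dec v ≟ y) ⊎-dec (u ≟ y ×-dec v ≟ x)

Joins-map : {A B : Set} (f : A → B) {x y u v : A} → Joins x y u v → Joins (f x) (f y) (f u) (f v)
Joins-map f = Sum.map (Product.map (cong f) (cong f)) (Product.map (cong f) (cong f))

Joins-injective : {A B : Set} {f : A → B} → Injective _≡_ _≡_ f → ∀ {x y u v} →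
  Joins (f x) (f y) (f u) (f v) → Joins x y u v
Joins-injective inj = Sum.map (Product.map inj inj) (Product.map inj inj)

Joins-trans : {A : Set} {x y u v s t : A} → Joins x y u v → Joins x y s t → Joins s t u v
Joins-trans (inj₁ (u≡x , v≡y)) (inj₁ (s≡x , t≡y)) = inj₁ (trans u≡x (sym s≡x) , trans v≡y (sym t≡y))
Joins-trans (inj₁ (u≡x , v≡y)) (inj₂ (s≡y , t≡x)) = inj₂ (trans u≡x (sym t≡x) , trans v≡y (sym s≡y))
Joins-trans (inj₂ (u≡y , v≡x)) (inj₁ (s≡x , t≡y)) = inj₂ (trans u≡y (sym t≡y) , trans v≡x (sym s≡x))
Joins-trans (inj₂ (u≡y , v≡x)) (inj₂ (s≡y , t≡x)) = inj₁ (trans u≡y (sym s≡y) , trans v≡x (sym t≡x))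

addEdge-spec : (G : Graph n) (x y u v : Fin n) → T (addEdge G x y u v) ⇔ (T (G u v) ⊎ Joins x y u v)
addEdge-spec G x y u v = mk⇔
  (Sum.map₂ (Sum.map (pair (u ≟ᶠ x) (v ≟ᶠ y)) (pair (u ≟ᶠ y) (v ≟ᶠ x)) ∘ to T-∨) ∘ to (T-∨ {G u v}))
  (from (T-∨ {G u v}) ∘ Sum.map₂ (from T-∨ ∘ Sum.map (unpair (u ≟ᶠ x) (v ≟ᶠ y)) (unpair (u ≟ᶠ y) (v ≟ᶠ x))))
  where
  pair : ∀ {A B : Set} (a? : Dec A) (b? : Dec B) → T (⌊ a? ⌋ ∧ ⌊ b? ⌋) → A × B
  pair a? b? = Product.map toWitness toWitness ∘ to (T-∧ {⌊ a? ⌋})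
  unpair : ∀ {A B : Set} (a? : Dec A) (b? : Dec B) → A × B → T (⌊ a? ⌋ ∧ ⌊ b? ⌋)
  unpair a? b? (a , b) = from (T-∧ {⌊ a? ⌋}) (fromWitness a , fromWitness b)

addEdge-⊇ : (G : Graph n) (x y : Fin n) → G ⊆ᴳ addEdge G x y
addEdge-⊇ G x y = from (addEdge-spec G x y _ _) ∘ inj₁

deleteEdge : Graph m → Fin m → Fin m → Graph m
deleteEdge F i j a b = F a b ∧ not ⌊ joins? _≟ᶠ_ i j a b ⌋

deleteEdge-spec : (F : Graph m) (i j a b : Fin m) → T (deleteEdge F i j a b) ⇔ (T (F a b) × ¬ Joins i j a b)
deleteEdge-spec F i j a b = mk⇔
  (Product.map₂ toWitnessFalse ∘ to (T-∧ {F a b}))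
  (from (T-∧ {F a b}) ∘ Product.map₂ fromWitnessFalse)

T-allB : ∀ {A : Set} (p : A → Bool) xs → T (allB p xs) ⇔ All (T ∘ p) xs
T-allB p []       = mk⇔ (λ _ → []) (λ _ → _)
T-allB p (x ∷ xs) = mk⇔
  (λ e → let (px , pxs) = to (T-∧ {p x}) e in px ∷ to (T-allB p xs) pxs)
  (λ { (px ∷ pxs) → from (T-∧ {p x}) (px , from (T-allB p xs) pxs) })

T-allB-allFin : (p : Fin m → Bool) → T (allB p (allFin m)) ⇔ (∀ i → T (p i))
T-allB-allFin p = mk⇔ (tabulate⁻ ∘ to (T-allB p _)) (from (T-allB p _) ∘ tabulate⁺)

record IsEmbedding (H : Graph m) (G : Graph n) (φ : Fin m → Fin n) : Set where
  field
    injective   : Injective _≡_ _≡_ φ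
    homomorphic : ∀ {i j} → T (H i j) → T (G (φ i) (φ j))

isEmbedding-spec : (H : Graph m) (G : Graph n) (φ : Fin m → Fin n) → T (isEmbedding H G φ) ⇔ IsEmbedding H G φ
isEmbedding-spec {m} H G φ = mk⇔
  (λ e → record
    { injective   = λ {i} {j} → to (injectiveAt (i ≟ᶠ j) (φ i ≟ᶠ φ j)) (proj₁ (pairAt e i j))
    ; homomorphic = λ {i} {j} → to (implication (H i j)) (proj₂ (pairAt e i j)) })
  (λ emb → from (T-allB-allFin _) λ i → from (T-allB-allFin _) λ j → from (T-∧ {⌊ i ≟ᶠ j ⌋ ∨ _})
    ( from (injectiveAt (i ≟ᶠ j) (φ i ≟ᶠ φ j)) (IsEmbedding.injective emb)
    , from (implication (H i j)) (IsEmbedding.homomorphic emb)))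
  where
  injectiveAt : ∀ {A B : Set} (a? : Dec A) (b? : Dec B) → T (⌊ a? ⌋ ∨ not ⌊ b? ⌋) ⇔ (B → A)
  injectiveAt (yes a) _       = mk⇔ (λ _ _ → a) _
  injectiveAt (no ¬a) (yes b) = mk⇔ (λ ()) (λ f → ¬a (f b))
  injectiveAt (no _)  (no ¬b) = mk⇔ (λ _ b → contradiction b ¬b) _
  implication : ∀ p {q} → T (not p ∨ q) ⇔ (T p → T q)
  implication true  = mk⇔ (λ q _ → q) (λ f → f _)
  implication false = mk⇔ (λ _ ()) _
  pairAt : T (isEmbedding H G φ) → (i j : Fin m) →
    T (⌊ i ≟ᶠ j ⌋ ∨ not ⌊ φ i ≟ᶠ φ j ⌋) × T (not (H i j) ∨ G (φ i) (φ j))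
  pairAt e i j = to (T-∧ {⌊ i ≟ᶠ j ⌋ ∨ _}) (to (T-allB-allFin _) (to (T-allB-allFin _) e i) j)

IsEmbedding-mono : {H : Graph m} {G G′ : Graph n} {φ : Fin m → Fin n} →
  G ⊆ᴳ G′ → IsEmbedding H G φ → IsEmbedding H G′ φ
IsEmbedding-mono G⊆G′ emb = record { injective = injective ; homomorphic = G⊆G′ ∘ homomorphic }
  where open IsEmbedding emb

IsEmbedding-∘ : {H : Graph m} {H′ : Graph k} {G : Graph n} {φ : Fin k → Fin n} {σ : Fin m → Fin k} →
  IsEmbedding H′ G φ → IsEmbedding H H′ σ → IsEmbedding H G (φ ∘ σ)
IsEmbedding-∘ φ-emb σ-emb = record
  { injective   = IsEmbedding.injective σ-emb ∘ IsEmbedding.injective φ-emb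
  ; homomorphic = IsEmbedding.homomorphic φ-emb ∘ IsEmbedding.homomorphic σ-emb }

IsEmbedding-resp-≗ : {H : Graph m} {G : Graph n} {φ ψ : Fin m → Fin n} →
  φ ≗ ψ → IsEmbedding H G φ → IsEmbedding H G ψ
IsEmbedding-resp-≗ {G = G} φ≗ψ emb = record
  { injective   = λ {i} {j} eq → injective (trans (φ≗ψ i) (trans eq (sym (φ≗ψ j))))
  ; homomorphic = λ {i} {j} h → subst₂ (λ u v → T (G u v)) (φ≗ψ i) (φ≗ψ j) (homomorphic h) }
  where open IsEmbedding emb

isEmbedding-resp-≗ : (H : Graph m) (G : Graph n) {φ ψ : Fin m → Fin n} →
  φ ≗ ψ → isEmbedding H G φ ≡ isEmbedding H G ψ
isEmbedding-resp-≗ H G {φ} {ψ} φ≗ψ = T-injective (mk⇔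
  (from (isEmbedding-spec H G ψ) ∘ IsEmbedding-resp-≗ φ≗ψ ∘ to (isEmbedding-spec H G φ))
  (from (isEmbedding-spec H G φ) ∘ IsEmbedding-resp-≗ (sym ∘ φ≗ψ) ∘ to (isEmbedding-spec H G ψ)))

≐⇒same-embeddings : {H : Graph m} {G G′ : Graph n} →
  G ≐ G′ → ∀ φ → IsEmbedding H G φ ⇔ IsEmbedding H G′ φ
≐⇒same-embeddings G≐G′ φ = mk⇔ (IsEmbedding-mono (λ {x} {y} → subst T (G≐G′ x y)))
                                 (IsEmbedding-mono (λ {x} {y} → subst T (sym (G≐G′ x y))))

nEmb-cong : (H : Graph m) {G G′ : Graph n} →
  (∀ φ → IsEmbedding H G φ ⇔ IsEmbedding H G′ φ) → nEmb H G ≡ nEmb H G′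
nEmb-cong H {G} {G′} same =
  cong length (filter-≐ (T? ∘ isEmbedding H G) (T? ∘ isEmbedding H G′) (⇒ , ⇐) (allMaps _ _))
  where
  ⇒ : ∀ {φ} → T (isEmbedding H G φ) → T (isEmbedding H G′ φ)
  ⇒ {φ} = from (isEmbedding-spec H G′ φ) ∘ to (same φ) ∘ to (isEmbedding-spec H G φ)
  ⇐ : ∀ {φ} → T (isEmbedding H G′ φ) → T (isEmbedding H G φ)
  ⇐ {φ} = from (isEmbedding-spec H G φ) ∘ from (same φ) ∘ to (isEmbedding-spec H G′ φ)

nCopies-cong : (H : Graph m) {G G′ : Graph n} →
  (∀ φ → IsEmbedding H G φ ⇔ IsEmbedding H G′ φ) → nCopies H G ≡ nCopies H G′
nCopies-cong H same = cong (λ e → divOrZero e (nEmb H H)) (nEmb-cong H same)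

step-spec : (H : Graph m) (G : Graph n) (x y : Fin n) →
  T (step H G x y) ⇔ (T (G x y) ⊎ (x ≢ y × nCopies H G < nCopies H (addEdge G x y)))
step-spec H G x y = mk⇔
  (Sum.map₂ (Product.map toWitnessFalse (ℕ.<ᵇ⇒< _ _) ∘ to (T-∧ {not ⌊ x ≟ᶠ y ⌋})) ∘ to (T-∨ {G x y}))
  (from (T-∨ {G x y}) ∘ Sum.map₂ (from (T-∧ {not ⌊ x ≟ᶠ y ⌋}) ∘ Product.map fromWitnessFalse ℕ.<⇒<ᵇ))

step-cong : (H : Graph m) {G G′ : Graph n} → G ≐ G′ → step H G ≐ step H G′
step-cong H {G} {G′} G≐G′ x y =
  cong₂ (λ g c → g ∨ (not ⌊ x ≟ᶠ y ⌋ ∧ c)) (G≐G′ x y)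
    (cong₂ _<ᵇ_ (nCopies-cong H (≐⇒same-embeddings G≐G′)) (nCopies-cong H (≐⇒same-embeddings addEdge-cong)))
  where
  addEdge-cong : addEdge G x y ≐ addEdge G′ x y
  addEdge-cong u v = cong (_∨ ((⌊ u ≟ᶠ x ⌋ ∧ ⌊ v ≟ᶠ y ⌋) ∨ (⌊ u ≟ᶠ y ⌋ ∧ ⌊ v ≟ᶠ x ⌋))) (G≐G′ u v)

-- Counting copies

length-filterᵇ-split : ∀ {A : Set} (p q : A → Bool) → (∀ {x} → T (p x) → T (q x)) → ∀ xs →
  length (filterᵇ q xs) ≡ length (filterᵇ p xs) + length (filterᵇ (λ x → q x ∧ not (p x)) xs)
length-filterᵇ-split p q p⇒q [] = refl
length-filterᵇ-split p q p⇒q (x ∷ xs) with p x in px | q x in qx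
... | true  | true  = cong suc (length-filterᵇ-split p q p⇒q xs)
... | true  | false = ⊥-elim (subst T qx (p⇒q (subst T (sym px) _)))
... | false | true  = trans (cong suc (length-filterᵇ-split p q p⇒q xs)) (sym (ℕ.+-suc _ _))
... | false | false = length-filterᵇ-split p q p⇒q xs

allMaps-complete : ∀ k n (ψ : Fin k → Fin n) → Any (_≗ ψ) (allMaps k n)
allMaps-complete zero    n ψ = here (λ ())
allMaps-complete (suc k) n ψ = concatMap⁺ _ (Any.map extend (allMaps-complete k n (ψ ∘ Fin.suc)))
  where
  extend : ∀ {f} → f ≗ ψ ∘ Fin.suc → Any (_≗ ψ) _
  extend f≗ψ = map⁺ (Any.map (λ ψ0≡v → λ { Fin.zero → sym ψ0≡v ; (Fin.suc i) → f≗ψ i }) (∈-allFin (ψ Fin.zero)))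

distinct-≤-count : (r : (Fin k → Fin n) → Bool) → (∀ {f g} → f ≗ g → r f ≡ r g) →
  (ψ : Fin a → Fin k → Fin n) → (∀ t → T (r (ψ t))) → (∀ {t s} → ψ t ≗ ψ s → t ≡ s) →
  a ≤ length (filterᵇ r (allMaps k n))
distinct-≤-count {k} {n} r r-resp ψ rψ ψ-distinct = injective⇒≤ {f = index ∘ found} λ {t} {s} eq →
  ψ-distinct λ i → trans (sym (lookup-index (found t) i))
                         (trans (cong (λ z → lookup (filterᵇ r (allMaps k n)) z i) eq) (lookup-index (found s) i))
  where
  found : ∀ t → Any (_≗ ψ t) (filterᵇ r (allMaps k n))
  found t = [ id , (λ ¬r → contradiction (subst T (sym (r-resp (lookup-result p))) (rψ t)) ¬r) ]′
              (filter⁺ (T? ∘ r) p)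
    where
    p : Any (_≗ ψ t) (allMaps k n)
    p = allMaps-complete k n (ψ t)

/-increases : ∀ a {c d} .{{_ : NonZero d}} → d ≤ c → a / d < (a + c) / d
/-increases a {c} {d} d≤c = begin-strict
  a / d                 <⟨ ℕ.n<1+n _ ⟩
  suc (a / d)           ≡⟨ cong (λ x → suc (x / d)) (sym (ℕ.m+n∸n≡m a d)) ⟩
  suc ((a + d ∸ d) / d) ≡⟨ sym (m/n≡1+[m∸n]/n (ℕ.m≤n+m d a)) ⟩
  (a + d) / d           ≤⟨ /-monoˡ-≤ d (ℕ.+-monoʳ-≤ a d≤c) ⟩
  (a + c) / d           ∎
  where open ℕ.≤-Reasoning

new-∘-involution : {H : Graph m} {G G′ : Graph n} {φ : Fin m → Fin n} {σ : Fin m → Fin m} →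
  IsEmbedding H H σ → (∀ i → σ (σ i) ≡ i) → IsEmbedding H G′ φ → ¬ IsEmbedding H G φ →
  IsEmbedding H G′ (φ ∘ σ) × ¬ IsEmbedding H G (φ ∘ σ)
new-∘-involution {φ = φ} σ-aut σ-invol emb′ ¬emb =
  IsEmbedding-∘ emb′ σ-aut , ¬emb ∘ IsEmbedding-resp-≗ (cong φ ∘ σ-invol) ∘ flip IsEmbedding-∘ σ-aut

record InvolutiveAutomorphisms (H : Graph m) (a : ℕ) : Set where
  field
    σ            : Fin a → Fin m → Fin m
    automorphism : ∀ t → IsEmbedding H H (σ t)
    involutive   : ∀ t i → σ t (σ t i) ≡ i
    distinct     : ∀ {t s} → σ t ≗ σ s → t ≡ s

-- nCopies divides by nEmb H H, so a new embedding must come with that many others: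
-- its composites with the automorphisms.
copies-increase : {H : Graph m} → InvolutiveAutomorphisms H (suc a) → nEmb H H ≡ suc a →
  {G G′ : Graph n} → G ⊆ᴳ G′ → (φ : Fin m → Fin n) → IsEmbedding H G′ φ → ¬ IsEmbedding H G φ →
  nCopies H G < nCopies H G′
copies-increase {m} {a} {n} {H} auts autCount {G} {G′} G⊆G′ φ emb′ ¬emb =
  subst₂ _<_ (sym (nCopies≡ G)) (sym (nCopies≡ G′)) (begin-strict
    nEmb H G / suc a               <⟨ /-increases (nEmb H G) orbit-count ⟩
    (nEmb H G + newCount) / suc a  ≡⟨ cong (_/ suc a) (sym split) ⟩
    nEmb H G′ / suc a              ∎)
  where
  open ℕ.≤-Reasoning
  open InvolutiveAutomorphisms auts
  nCopies≡ : (G″ : Graph n) → nCopies H G″ ≡ nEmb H G″ / suc a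
  nCopies≡ G″ = cong (divOrZero (nEmb H G″)) autCount
  new : (Fin m → Fin n) → Bool
  new ψ = isEmbedding H G′ ψ ∧ not (isEmbedding H G ψ)
  newCount : ℕ
  newCount = length (filterᵇ new (allMaps m n))
  split : nEmb H G′ ≡ nEmb H G + newCount
  split = length-filterᵇ-split (isEmbedding H G) (isEmbedding H G′)
    (λ {ψ} → from (isEmbedding-spec H G′ ψ) ∘ IsEmbedding-mono G⊆G′ ∘ to (isEmbedding-spec H G ψ)) (allMaps m n)
  new-resp : ∀ {f g} → f ≗ g → new f ≡ new g
  new-resp f≗g = cong₂ (λ p q → p ∧ not q) (isEmbedding-resp-≗ H G′ f≗g) (isEmbedding-resp-≗ H G f≗g)
  orbit-new : ∀ t → T (new (φ ∘ σ t))
  orbit-new t = from (T-∧ {isEmbedding H G′ (φ ∘ σ t)})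
    ( from (isEmbedding-spec H G′ (φ ∘ σ t)) (proj₁ still-new)
    , not-T (proj₂ still-new ∘ to (isEmbedding-spec H G (φ ∘ σ t))))
    where
    still-new : IsEmbedding H G′ (φ ∘ σ t) × ¬ IsEmbedding H G (φ ∘ σ t)
    still-new = new-∘-involution (automorphism t) (involutive t) emb′ ¬emb
    not-T : ∀ {p} → ¬ T p → T (not p)
    not-T {false} _  = _
    not-T {true}  ¬p = ¬p _
  orbit-distinct : ∀ {t s} → φ ∘ σ t ≗ φ ∘ σ s → t ≡ s
  orbit-distinct eq = distinct (IsEmbedding.injective emb′ ∘ eq)
  orbit-count : suc a ≤ newCount
  orbit-count = distinct-≤-count new new-resp (λ t → φ ∘ σ t) orbit-new orbit-distinct

-- The graphs T_k

parity-suc : ∀ a → parity (suc a) ≢ parity a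
parity-suc a eq = ℙ.p≢p⁻¹ (parity (suc a)) (sym (trans (ℙ.suc-homo-⁻¹ a) (sym eq)))

parity-3+ : ∀ a → parity (3 + a) ≢ parity a
parity-3+ = parity-suc

≢-≢⇒≡ : {p q r : Parity} → p ≢ q → q ≢ r → p ≡ r
≢-≢⇒≡ {0ℙ} {1ℙ} {0ℙ} _ _ = refl
≢-≢⇒≡ {1ℙ} {0ℙ} {1ℙ} _ _ = refl
≢-≢⇒≡ {0ℙ} {0ℙ} p≢q _ = contradiction refl p≢q
≢-≢⇒≡ {1ℙ} {1ℙ} p≢q _ = contradiction refl p≢q
≢-≢⇒≡ {_} {0ℙ} {0ℙ} _ q≢r = contradiction refl q≢r
≢-≢⇒≡ {_} {1ℙ} {1ℙ} _ q≢r = contradiction refl q≢r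

Consecutive : ℕ → ℕ → Set
Consecutive a b = suc a ≡ b ⊎ suc b ≡ a

-- The edges of T_k on ℕ: the block {0, …, k} with its two parity classes completely joined,
-- and the path through k, k+1, ….
Edge : ℕ → ℕ → ℕ → Set
Edge k a b = (a ≤ k × b ≤ k × parity a ≢ parity b) ⊎ Consecutive a b

edge? : ∀ k a b → Dec (Edge k a b)
edge? k a b = (a ≤? k ×-dec b ≤? k ×-dec ¬? (parity a ℙ.≟ parity b)) ⊎-dec (suc a ℕ.≟ b ⊎-dec suc b ℕ.≟ a)

lollipop : (n k : ℕ) → Graph n
lollipop n k u v = ⌊ edge? k (toℕ u) (toℕ v) ⌋

Consecutive-parity : Consecutive a b → parity a ≢ parity b
Consecutive-parity {a}     (inj₁ refl) = parity-suc a ∘ sym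
Consecutive-parity {b = b} (inj₂ refl) = parity-suc b

Consecutive-beyond : k < a → Consecutive a b → k ≤ b
Consecutive-beyond k<a (inj₁ refl) = ℕ.m≤n⇒m≤1+n (ℕ.<⇒≤ k<a)
Consecutive-beyond k<a (inj₂ refl) = ℕ.≤-pred k<a

Edge-parity : Edge k a b → parity a ≢ parity b
Edge-parity (inj₁ (_ , _ , pa≢pb)) = pa≢pb
Edge-parity (inj₂ c)               = Consecutive-parity c

Edge-irrefl : ¬ Edge k a a
Edge-irrefl e = Edge-parity e refl

Edge-sym : Edge k a b → Edge k b a
Edge-sym (inj₁ (a≤k , b≤k , pa≢pb)) = inj₁ (b≤k , a≤k , pa≢pb ∘ sym)
Edge-sym (inj₂ c)                   = inj₂ (Sum.swap c)

Edge-mono : k ≤ d → Edge k a b → Edge d a b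
Edge-mono k≤d (inj₁ (a≤k , b≤k , pa≢pb)) = inj₁ (ℕ.≤-trans a≤k k≤d , ℕ.≤-trans b≤k k≤d , pa≢pb)
Edge-mono _   (inj₂ c)                   = inj₂ c

Edge-block-or-tail : Edge k a b → (a ≤ k × b ≤ k × parity a ≢ parity b) ⊎ (k ≤ a × k ≤ b × Consecutive a b)
Edge-block-or-tail (inj₁ block) = inj₁ block
Edge-block-or-tail {k} {a} {b} (inj₂ c) with a ≤? k | b ≤? k
... | yes a≤k | yes b≤k = inj₁ (a≤k , b≤k , Consecutive-parity c)
... | no a≰k  | _       = inj₂ (ℕ.<⇒≤ (ℕ.≰⇒> a≰k) , Consecutive-beyond (ℕ.≰⇒> a≰k) c , c)
... | _       | no b≰k  = inj₂ (Consecutive-beyond (ℕ.≰⇒> b≰k) (Sum.swap c) , ℕ.<⇒≤ (ℕ.≰⇒> b≰k) , c)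

Edge-above : k < b → Edge k a b → Consecutive a b
Edge-above k<b e with Edge-block-or-tail e
... | inj₁ (_ , b≤k , _) = contradiction b≤k (ℕ.<⇒≱ k<b)
... | inj₂ (_ , _ , c)   = c

Edge-peak : k < b → Edge k a b → Edge k c b → a ≢ c → a ≡ suc b ⊎ c ≡ suc b
Edge-peak k<b e₁ e₂ a≢c with Edge-above k<b e₁ | Edge-above k<b e₂
... | inj₁ sa≡b | inj₁ sc≡b = contradiction (ℕ.suc-injective (trans sa≡b (sym sc≡b))) a≢c
... | inj₂ sb≡a | _         = inj₁ (sym sb≡a)
... | _         | inj₂ sb≡c = inj₂ (sym sb≡c)

Edge-≤-suc : Edge k a b → k ≤ d → b ≤ d → a ≤ suc d
Edge-≤-suc (inj₁ (a≤k , _ , _)) k≤d _   = ℕ.m≤n⇒m≤1+n (ℕ.≤-trans a≤k k≤d)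
Edge-≤-suc (inj₂ (inj₁ refl))   _   b≤d = ℕ.m≤n⇒m≤1+n (ℕ.<⇒≤ b≤d)
Edge-≤-suc (inj₂ (inj₂ refl))   _   b≤d = s≤s b≤d

Edge-+ : ∀ d → Edge c a b → Edge (c + d) (a + d) (b + d)
Edge-+ {a = a} {b} d (inj₁ (a≤c , b≤c , pa≢pb)) =
  inj₁ (ℕ.+-monoˡ-≤ d a≤c , ℕ.+-monoˡ-≤ d b≤c ,
        λ eq → pa≢pb (ℙ.+-cancelʳ-≡ (parity d) _ _ (trans (sym (ℙ.+-homo-+ a d)) (trans eq (ℙ.+-homo-+ b d)))))
Edge-+ d (inj₂ (inj₁ refl)) = inj₂ (inj₁ refl)
Edge-+ d (inj₂ (inj₂ refl)) = inj₂ (inj₂ refl)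

-- The highest vertex of such a family has two distinct neighbours that are not higher,
-- which Edge-peak forbids above the block.
core-in-block : {A : Set} (v : A → ℕ) (C : List A) →
  (∀ {s} → s ∈ C → ∃₂ λ u w → u ∈ C × w ∈ C × v u ≢ v w × Edge k (v u) (v s) × Edge k (v w) (v s)) →
  ∀ {s} → s ∈ C → v s ≤ k
core-in-block {k} {A} v C two {s} s∈C = ℕ.≤-trans (f[⊥]≤f[argmax] {f = v} s C) top≤k
  where
  top : A
  top = argmax v s C
  below-top : ∀ {x} → x ∈ C → v x ≤ v top
  below-top = All.lookup (f[xs]≤f[argmax] {f = v} s C)
  top≤k : v top ≤ k
  top≤k with v top ≤? k
  ... | yes ≤k = ≤k
  ... | no ≰k with two (argmax-all v {P = _∈ C} s∈C (All.tabulate id))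
  ...   | u , w , u∈C , w∈C , vu≢vw , eu , ew =
    ⊥-elim ([ above u∈C , above w∈C ]′ (Edge-peak (ℕ.≰⇒> ≰k) eu ew vu≢vw))
    where
    above : ∀ {x} → x ∈ C → v x ≢ suc (v top)
    above x∈C eq = ℕ.1+n≰n (subst (_≤ v top) eq (below-top x∈C))

swap : ℕ → ℕ → ℕ → ℕ
swap a b u with u ℕ.≟ a
... | yes _ = b
... | no _  with u ℕ.≟ b
...   | yes _ = a
...   | no _  = u

swap-spec : ∀ a b u →
  (u ≡ a × swap a b u ≡ b) ⊎ (u ≡ b × swap a b u ≡ a) ⊎ (u ≢ a × u ≢ b × swap a b u ≡ u)
swap-spec a b u with u ℕ.≟ a
... | yes u≡a = inj₁ (u≡a , refl)
... | no u≢a  with u ℕ.≟ b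
...   | yes u≡b = inj₂ (inj₁ (u≡b , refl))
...   | no u≢b  = inj₂ (inj₂ (u≢a , u≢b , refl))

swap-left : ∀ a b → swap a b a ≡ b
swap-left a b with swap-spec a b a
... | inj₁ (_ , sa≡b)          = sa≡b
... | inj₂ (inj₁ (a≡b , sa≡a)) = trans sa≡a a≡b
... | inj₂ (inj₂ (a≢a , _))    = contradiction refl a≢a

swap-right : ∀ a b → swap a b b ≡ a
swap-right a b with swap-spec a b b
... | inj₁ (b≡a , sb≡b)         = trans sb≡b b≡a
... | inj₂ (inj₁ (_ , sb≡a))    = sb≡a
... | inj₂ (inj₂ (_ , b≢b , _)) = contradiction refl b≢b

swap-fixes : ∀ {a b u} → u ≢ a → u ≢ b → swap a b u ≡ u
swap-fixes {a} {b} {u} u≢a u≢b with swap-spec a b u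
... | inj₁ (u≡a , _)            = contradiction u≡a u≢a
... | inj₂ (inj₁ (u≡b , _))     = contradiction u≡b u≢b
... | inj₂ (inj₂ (_ , _ , s≡u)) = s≡u

swap-involutive : ∀ a b u → swap a b (swap a b u) ≡ u
swap-involutive a b u with swap-spec a b u
... | inj₁ (u≡a , su≡b)          = trans (cong (swap a b) su≡b) (trans (swap-right a b) (sym u≡a))
... | inj₂ (inj₁ (u≡b , su≡a))   = trans (cong (swap a b) su≡a) (trans (swap-left a b) (sym u≡b))
... | inj₂ (inj₂ (_ , _ , su≡u)) = trans (cong (swap a b) su≡u) su≡u

swap-injective : ∀ a b → Injective _≡_ _≡_ (swap a b)
swap-injective a b {u} {v} eq =
  trans (sym (swap-involutive a b u)) (trans (cong (swap a b) eq) (swap-involutive a b v))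

swap-≤ : a ≤ d → b ≤ d → c ≤ d → swap a b c ≤ d
swap-≤ {a} {d} {b} {c} a≤d b≤d c≤d with swap-spec a b c
... | inj₁ (_ , s≡b)            = subst (_≤ d) (sym s≡b) b≤d
... | inj₂ (inj₁ (_ , s≡a))     = subst (_≤ d) (sym s≡a) a≤d
... | inj₂ (inj₂ (_ , _ , s≡c)) = subst (_≤ d) (sym s≡c) c≤d

swap-parity : parity a ≡ parity b → ∀ c → parity (swap a b c) ≡ parity c
swap-parity {a} {b} pa≡pb c with swap-spec a b c
... | inj₁ (refl , s≡b)         = trans (cong parity s≡b) (sym pa≡pb)
... | inj₂ (inj₁ (refl , s≡a))  = trans (cong parity s≡a) pa≡pb
... | inj₂ (inj₂ (_ , _ , s≡c)) = cong parity s≡c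

-- The block is complete bipartite and the tail meets it only at k,
-- so vertices of equal parity below k are interchangeable.
swap-Edge : a < k → b < k → parity a ≡ parity b → Edge k c d → Edge k (swap a b c) (swap a b d)
swap-Edge {a} {k} {b} {c} {d} a<k b<k pa≡pb e with Edge-block-or-tail e
... | inj₁ (c≤k , d≤k , pc≢pd) =
  inj₁ ( swap-≤ (ℕ.<⇒≤ a<k) (ℕ.<⇒≤ b<k) c≤k , swap-≤ (ℕ.<⇒≤ a<k) (ℕ.<⇒≤ b<k) d≤k
       , λ eq → pc≢pd (trans (sym (swap-parity pa≡pb c)) (trans eq (swap-parity pa≡pb d))))
... | inj₂ (k≤c , k≤d , _) = subst₂ (Edge k) (sym (fixed k≤c)) (sym (fixed k≤d)) e
  where
  fixed : ∀ {u} → k ≤ u → swap a b u ≡ u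
  fixed k≤u = swap-fixes (ℕ.>⇒≢ (ℕ.<-≤-trans a<k k≤u)) (ℕ.>⇒≢ (ℕ.<-≤-trans b<k k≤u))

-- The graph H̃

Htilde-automorphisms : InvolutiveAutomorphisms Htilde 4
Htilde-automorphisms = record
  { σ            = σ
  ; automorphism = λ t → to (isEmbedding-spec Htilde Htilde (σ t))
                             (from-yes (all? λ t → T? (isEmbedding Htilde Htilde (σ t))) t)
  ; involutive   = from-yes (all? λ t → all? λ i → σ t (σ t i) ≟ᶠ i)
  ; distinct     = λ {t} {s} σt≗σs →
                     from-yes (all? λ t → all? λ s → σ t 1F ≟ᶠ σ s 1F →-dec t ≟ᶠ s) t s (σt≗σs 1F) }
  where
  -- i ↦ i, 3 - i, - i and i + 3 modulo 6
  σ : Fin 4 → Fin 6 → Fin 6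
  σ 0F = id
  σ 1F = λ { 0F → 3F ; 1F → 2F ; 2F → 1F ; 3F → 0F ; 4F → 5F ; 5F → 4F }
  σ 2F = λ { 0F → 0F ; 1F → 5F ; 2F → 4F ; 3F → 3F ; 4F → 2F ; 5F → 1F }
  σ 3F = λ { 0F → 3F ; 1F → 4F ; 2F → 5F ; 3F → 0F ; 4F → 1F ; 5F → 2F }

Htilde-selfEmbeddings : nEmb Htilde Htilde ≡ 4
Htilde-selfEmbeddings = refl

TwoNeighboursIn : Graph m → List (Fin m) → Fin m → Set
TwoNeighboursIn F C s = ∃₂ λ u w → u ∈ C × w ∈ C × u ≢ w × T (F u s) × T (F w s)

WithinOne : Graph m → Fin m → Fin m → Set
WithinOne F s u = s ≡ u ⊎ T (F s u)

WithinTwo : Graph m → List (Fin m) → Fin m → Set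
WithinTwo F C s = ∃₂ λ u c → c ∈ C × WithinOne F s u × WithinOne F u c

Path₃ : Graph m → Fin m → Fin m → Set
Path₃ F i j = ∃₂ λ a b → T (F i a) × T (F a b) × T (F b j)

Htilde-cycles : List (List (Fin 6))
Htilde-cycles = (0F ∷ 1F ∷ 2F ∷ 3F ∷ []) ∷ (0F ∷ 3F ∷ 4F ∷ 5F ∷ [])
              ∷ (0F ∷ 1F ∷ 2F ∷ 3F ∷ 4F ∷ 5F ∷ []) ∷ []

Certificate : Fin 6 → Fin 6 → Set
Certificate i j =
  Any (λ C → All (TwoNeighboursIn F C) C × WithinTwo F C i × WithinTwo F C j) Htilde-cycles × Path₃ F i j
  where
  F : Graph 6
  F = deleteEdge Htilde i j

certificate : ∀ i j → T (Htilde i j) → Certificate i j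
certificate = from-yes (all? λ i → all? λ j → T? (Htilde i j) →-dec certificate? i j)
  where
  certificate? : ∀ i j → Dec (Certificate i j)
  certificate? i j =
    Any.any? (λ C → All.all? (twoNeighbours? C) C ×-dec withinTwo? C i ×-dec withinTwo? C j) Htilde-cycles
      ×-dec (any? λ (a : Fin 6) → any? λ (b : Fin 6) → T? (F i a) ×-dec T? (F a b) ×-dec T? (F b j))
    where
    F : Graph 6
    F = deleteEdge Htilde i j
    twoNeighbours? : ∀ C s → Dec (TwoNeighboursIn F C s)
    twoNeighbours? C s = any? λ (u : Fin 6) → any? λ (w : Fin 6) →
      Any.any? (u ≟ᶠ_) C ×-dec Any.any? (w ≟ᶠ_) C ×-dec ¬? (u ≟ᶠ w) ×-dec T? (F u s) ×-dec T? (F w s)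
    withinOne? : ∀ s u → Dec (WithinOne F s u)
    withinOne? s u = s ≟ᶠ u ⊎-dec T? (F s u)
    withinTwo? : ∀ C s → Dec (WithinTwo F C s)
    withinTwo? C s = any? λ (u : Fin 6) → any? λ (c : Fin 6) →
      Any.any? (c ≟ᶠ_) C ×-dec withinOne? s u ×-dec withinOne? u c

-- One step of the process on T_k

-- The cycle lies in the block by core-in-block, so v i, v j ≤ k + 2, and the odd path separates their parities.
deleteEdge-closes : {v : Fin 6 → ℕ} → Injective _≡_ _≡_ v → ∀ {i j} → T (Htilde i j) →
  (∀ {a b} → T (deleteEdge Htilde i j a b) → Edge k (v a) (v b)) → Edge (2 + k) (v i) (v j)
deleteEdge-closes {k} {v} v-injective {i} {j} ij hom = closes (certificate i j ij)
  where
  F : Graph 6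
  F = deleteEdge Htilde i j
  closes : Certificate i j → Edge (2 + k) (v i) (v j)
  closes (cycle , (a , b , ia , ab , bj)) with Any.satisfied cycle
  ... | C , core , near-i , near-j = inj₁ (withinTwo-≤ near-i , withinTwo-≤ near-j , parity-path)
    where
    in-block : ∀ {s} → s ∈ C → v s ≤ k
    in-block = core-in-block v C λ s∈C →
      let (u , w , u∈C , w∈C , u≢w , us , ws) = All.lookup core s∈C
      in u , w , u∈C , w∈C , u≢w ∘ v-injective , hom us , hom ws
    withinOne-≤ : ∀ {s u d} → WithinOne F s u → k ≤ d → v u ≤ d → v s ≤ suc d
    withinOne-≤ (inj₁ refl) _   vu≤d = ℕ.m≤n⇒m≤1+n vu≤d
    withinOne-≤ (inj₂ su)   k≤d vu≤d = Edge-≤-suc (hom su) k≤d vu≤d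
    withinTwo-≤ : ∀ {s} → WithinTwo F C s → v s ≤ 2 + k
    withinTwo-≤ (u , c , c∈C , su , uc) = withinOne-≤ su (ℕ.n≤1+n k) (withinOne-≤ uc ℕ.≤-refl (in-block c∈C))
    parity-path : parity (v i) ≢ parity (v j)
    parity-path = Edge-parity (hom bj) ∘ trans (sym (≢-≢⇒≡ (Edge-parity (hom ia)) (Edge-parity (hom ab))))

no-new-embeddings : (x y : Fin n) → ¬ Edge (2 + k) (toℕ x) (toℕ y) →
  ∀ {φ} → IsEmbedding Htilde (addEdge (lollipop n k) x y) φ → IsEmbedding Htilde (lollipop n k) φ
no-new-embeddings {n} {k} x y ¬xy {φ} emb = record { injective = injective ; homomorphic = old }
  where
  open IsEmbedding emb
  edge-or-joins : ∀ {a b} → T (Htilde a b) → T (lollipop n k (φ a) (φ b)) ⊎ Joins x y (φ a) (φ b)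
  edge-or-joins ab = to (addEdge-spec (lollipop n k) x y _ _) (homomorphic ab)
  old : ∀ {i j} → T (Htilde i j) → T (lollipop n k (φ i) (φ j))
  old {i} {j} ij with edge-or-joins ij
  ... | inj₁ e     = e
  ... | inj₂ ij↦xy = contradiction (joined ij↦xy (deleteEdge-closes (injective ∘ toℕ-injective) ij hom)) ¬xy
    where
    hom : ∀ {a b} → T (deleteEdge Htilde i j a b) → Edge k (toℕ (φ a)) (toℕ (φ b))
    hom {a} {b} del with to (deleteEdge-spec Htilde i j a b) del
    ... | ab , ab≠ij with edge-or-joins ab
    ...   | inj₁ e     = toWitness e
    ...   | inj₂ ab↦xy = contradiction (Joins-injective injective (Joins-trans ab↦xy ij↦xy)) ab≠ij
    joined : Joins x y (φ i) (φ j) → Edge (2 + k) (toℕ (φ i)) (toℕ (φ j)) → Edge (2 + k) (toℕ x) (toℕ y)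
    joined (inj₁ (i↦x , j↦y)) = subst₂ (Edge (2 + k)) (cong toℕ i↦x) (cong toℕ j↦y)
    joined (inj₂ (i↦y , j↦x)) = Edge-sym ∘ subst₂ (Edge (2 + k)) (cong toℕ i↦y) (cong toℕ j↦x)

record NewEmbedding (H : Graph m) (k Q P : ℕ) (w : Fin m → ℕ) : Set where
  field
    injective : Injective _≡_ _≡_ w
    edges     : ∀ {a b} → T (H a b) → Edge k (w a) (w b) ⊎ Joins Q P (w a) (w b)
    uses      : ∃₂ λ i j → T (H i j) × w i ≡ Q × w j ≡ P

newEmbedding? : (H : Graph m) (k Q P : ℕ) (w : Fin m → ℕ) → Dec (NewEmbedding H k Q P w)
newEmbedding? H k Q P w = map′
  (λ (inj , edges , uses) → record { injective = λ {a} {b} → inj a b ; edges = λ {a} {b} → edges a b ; uses = uses })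
  (λ new → (λ _ _ → NewEmbedding.injective new) , (λ _ _ → NewEmbedding.edges new) , NewEmbedding.uses new)
  (   (all? λ a → all? λ b → w a ℕ.≟ w b →-dec a ≟ᶠ b)
  ×-dec (all? λ a → all? λ b → T? (H a b) →-dec (edge? k (w a) (w b) ⊎-dec joins? ℕ._≟_ Q P (w a) (w b)))
  ×-dec (any? λ i → any? λ j → T? (H i j) ×-dec w i ℕ.≟ Q ×-dec w j ℕ.≟ P))

NewEmbedding-+ : {H : Graph m} {Q P : ℕ} {w : Fin m → ℕ} → ∀ d →
  NewEmbedding H c Q P w → NewEmbedding H (c + d) (Q + d) (P + d) ((_+ d) ∘ w)
NewEmbedding-+ d new = record
  { injective = injective ∘ ℕ.+-cancelʳ-≡ d _ _
  ; edges     = Sum.map (Edge-+ d) (Joins-map (_+ d)) ∘ edges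
  ; uses      = let (i , j , ij , i↦Q , j↦P) = uses in i , j , ij , cong (_+ d) i↦Q , cong (_+ d) j↦P }
  where open NewEmbedding new

NewEmbedding-swap : {H : Graph m} {Q : ℕ} {w : Fin m → ℕ} →
  a < k → b < k → parity a ≡ parity b → Q ≢ a → Q ≢ b →
  NewEmbedding H k Q a w → NewEmbedding H k Q b (swap a b ∘ w)
NewEmbedding-swap {a = a} {b = b} {Q = Q} {w} a<k b<k pa≡pb Q≢a Q≢b new = record
  { injective = injective ∘ swap-injective a b
  ; edges     = λ {u} {v} uv → Sum.map (swap-Edge a<k b<k pa≡pb)
      (subst₂ (λ q p → Joins q p (swap a b (w u)) (swap a b (w v))) Q-fixed (swap-left a b) ∘ Joins-map (swap a b))
      (edges uv)
  ; uses      = let (i , j , ij , i↦Q , j↦a) = uses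
                in i , j , ij , trans (cong (swap a b) i↦Q) Q-fixed , trans (cong (swap a b) j↦a) (swap-left a b) }
  where
  open NewEmbedding new
  Q-fixed : swap a b Q ≡ Q
  Q-fixed = swap-fixes Q≢a Q≢b

NewEmbedding-lift : {H : Graph m} {Q P : ℕ} {w : Fin m → ℕ} →
  NewEmbedding H k Q P w → (∀ a → w a ≤ Q) → ¬ Edge k Q P →
  (x y : Fin n) → Joins Q P (toℕ x) (toℕ y) →
  ∃ λ φ → IsEmbedding H (addEdge (lollipop n k) x y) φ × ¬ IsEmbedding H (lollipop n k) φ
NewEmbedding-lift {m = m} {k = k} {n = n} {H = H} {Q} {P} {w} new w≤Q ¬QP x y xy↦QP = φ , embedding , not-old
  where
  open NewEmbedding new
  Q<n : Q < n
  Q<n = [ (λ (x≡Q , _) → subst (_< n) x≡Q (toℕ<n x)) , (λ (_ , y≡Q) → subst (_< n) y≡Q (toℕ<n y)) ]′ xy↦QP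
  φ : Fin m → Fin n
  φ a = fromℕ< (ℕ.≤-<-trans (w≤Q a) Q<n)
  toℕ-φ : ∀ a → toℕ (φ a) ≡ w a
  toℕ-φ a = toℕ-fromℕ< _
  embedding : IsEmbedding H (addEdge (lollipop n k) x y) φ
  embedding = record
    { injective   = λ {a} {b} eq → injective (trans (sym (toℕ-φ a)) (trans (cong toℕ eq) (toℕ-φ b)))
    ; homomorphic = λ {a} {b} ab → from (addEdge-spec (lollipop n k) x y (φ a) (φ b))
        (Sum.map (λ e → fromWitness (subst₂ (Edge k) (sym (toℕ-φ a)) (sym (toℕ-φ b)) e))
                 (λ ab↦QP → Joins-injective toℕ-injective
                   (subst₂ (Joins (toℕ x) (toℕ y)) (sym (toℕ-φ a)) (sym (toℕ-φ b)) (Joins-trans ab↦QP xy↦QP)))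
                 (edges ab)) }
  not-old : ¬ IsEmbedding H (lollipop n k) φ
  not-old old with uses
  ... | i , j , ij , i↦Q , j↦P =
    ¬QP (subst₂ (Edge k) (trans (toℕ-φ i) i↦Q) (trans (toℕ-φ j) j↦P) (toWitness (IsEmbedding.homomorphic old ij)))

-- Every new copy of H̃ in step-lollipop is one of these two, translated and with 2 exchanged inside the block.
window₄ : Fin 6 → Fin 6
window₄ = λ { 0F → 4F ; 1F → 5F ; 2F → 2F ; 3F → 3F ; 4F → 0F ; 5F → 1F }

window₃ : Fin 6 → Fin 6
window₃ = λ { 0F → 2F ; 1F → 5F ; 2F → 4F ; 3F → 3F ; 4F → 0F ; 5F → 1F }

window₄-new : NewEmbedding Htilde 4 5 2 (toℕ ∘ window₄)
window₄-new = from-yes (newEmbedding? Htilde 4 5 2 (toℕ ∘ window₄))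

window₃-new : NewEmbedding Htilde 3 5 2 (toℕ ∘ window₃)
window₃-new = from-yes (newEmbedding? Htilde 3 5 2 (toℕ ∘ window₃))

new-edge-shape : {Q P : ℕ} → Edge (2 + k) Q P → ¬ Edge k Q P → P < Q →
  (Q ≡ suc k ⊎ Q ≡ 2 + k) × 3 + P ≤ Q
new-edge-shape             (inj₂ c)                ¬e _   = contradiction (inj₂ c) ¬e
new-edge-shape {k} {Q} {P} (inj₁ (Q≤ , _ , pQ≢pP)) ¬e P<Q =
  top , ℕ.≤∧≢⇒< (ℕ.≤∧≢⇒< P<Q not-consecutive) not-two-apart
  where
  not-consecutive : suc P ≢ Q
  not-consecutive = ¬e ∘ inj₂ ∘ inj₂
  not-two-apart : 2 + P ≢ Q
  not-two-apart = pQ≢pP ∘ sym ∘ cong parity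
  top : Q ≡ suc k ⊎ Q ≡ 2 + k
  top with Q ≤? k | Q ℕ.≟ suc k
  ... | yes Q≤k | _      = contradiction (inj₁ (Q≤k , ℕ.≤-trans (ℕ.<⇒≤ P<Q) Q≤k , pQ≢pP)) ¬e
  ... | no _    | yes eq = inj₁ eq
  ... | no Q≰k  | no Q≢  = inj₂ (ℕ.≤-antisym Q≤ (ℕ.≤∧≢⇒< (ℕ.≰⇒> Q≰k) (Q≢ ∘ sym)))

from-window : (W : Fin 6 → Fin 6) → NewEmbedding Htilde c 5 2 (toℕ ∘ W) → 3 ≤ c →
  ∀ d {P} → P ≤ 2 + d → parity P ≡ parity (2 + d) →
  ∃ λ w → NewEmbedding Htilde (c + d) (5 + d) P w × (∀ a → w a ≤ 5 + d)
from-window {c} W new 3≤c d {P} P≤2+d pP≡ =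
    swap (2 + d) P ∘ (_+ d) ∘ toℕ ∘ W
  , NewEmbedding-swap 2+d<c+d (ℕ.≤-<-trans P≤2+d 2+d<c+d) (sym pP≡)
      (ℕ.>⇒≢ 2+d<5+d) (ℕ.>⇒≢ (ℕ.≤-<-trans P≤2+d 2+d<5+d))
      (NewEmbedding-+ d new)
  , λ a → swap-≤ (ℕ.<⇒≤ 2+d<5+d) (ℕ.≤-trans P≤2+d (ℕ.<⇒≤ 2+d<5+d)) (ℕ.+-monoˡ-≤ d (ℕ.≤-pred (toℕ<n (W a))))
  where
  2+d<c+d : 2 + d < c + d
  2+d<c+d = ℕ.+-monoˡ-≤ d 3≤c
  2+d<5+d : 2 + d < 5 + d
  2+d<5+d = ℕ.m≤n+m (3 + d) 2

new-copy : {Q P : ℕ} → 4 ≤ k → Edge (2 + k) Q P → ¬ Edge k Q P → P < Q →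
  ∃ λ w → NewEmbedding Htilde k Q P w × (∀ a → w a ≤ Q)
new-copy (s≤s (s≤s (s≤s (s≤s (z≤n {m}))))) e ¬e P<Q with new-edge-shape e ¬e P<Q
... | inj₁ refl , gap = from-window window₄ window₄-new (s≤s (s≤s (s≤s z≤n))) m (ℕ.+-cancelˡ-≤ 3 _ _ gap)
                          (≢-≢⇒≡ (Edge-parity (Edge-sym e)) (parity-3+ (2 + m)))
... | inj₂ refl , gap = from-window window₃ window₃-new ℕ.≤-refl (suc m) (ℕ.+-cancelˡ-≤ 3 _ _ gap)
                          (≢-≢⇒≡ (Edge-parity (Edge-sym e)) (parity-3+ (3 + m)))

step-lollipop : ∀ n k → 4 ≤ k → step Htilde (lollipop n k) ≐ lollipop n (2 + k)
step-lollipop n k 4≤k x y = T-injective (mk⇔ step⊆T[2+k] T[2+k]⊆step)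
  where
  G : Graph n
  G = lollipop n k
  x≢y : Edge (2 + k) (toℕ x) (toℕ y) → x ≢ y
  x≢y e refl = Edge-irrefl e
  more-copies⇒T[2+k] : nCopies Htilde G < nCopies Htilde (addEdge G x y) → Edge (2 + k) (toℕ x) (toℕ y)
  more-copies⇒T[2+k] more = decidable-stable (edge? (2 + k) (toℕ x) (toℕ y)) λ ¬e →
    ℕ.<-irrefl (nCopies-cong Htilde {G} {addEdge G x y} λ φ →
                  mk⇔ (IsEmbedding-mono (addEdge-⊇ G x y)) (no-new-embeddings {k = k} x y ¬e)) more
  step⊆T[2+k] : T (step Htilde G x y) → T (lollipop n (2 + k) x y)
  step⊆T[2+k] s = fromWitness ([ Edge-mono (ℕ.m≤n+m k 2) ∘ toWitness , more-copies⇒T[2+k] ∘ proj₂ ]′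
                                 (to (step-spec Htilde G x y) s))
  new-embedding : Edge (2 + k) (toℕ x) (toℕ y) → ¬ Edge k (toℕ x) (toℕ y) →
    ∃ λ φ → IsEmbedding Htilde (addEdge G x y) φ × ¬ IsEmbedding Htilde G φ
  new-embedding e ¬e with ℕ.<-cmp (toℕ x) (toℕ y)
  ... | tri< x<y _ _ = let (w , new , w≤) = new-copy 4≤k (Edge-sym e) (¬e ∘ Edge-sym) x<y
                       in NewEmbedding-lift new w≤ (¬e ∘ Edge-sym) x y (inj₂ (refl , refl))
  ... | tri≈ _ x≡y _ = contradiction (toℕ-injective x≡y) (x≢y e)
  ... | tri> _ _ y<x = let (w , new , w≤) = new-copy 4≤k e ¬e y<x
                       in NewEmbedding-lift new w≤ ¬e x y (inj₁ (refl , refl))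
  T[2+k]⊆step : T (lollipop n (2 + k) x y) → T (step Htilde G x y)
  T[2+k]⊆step t = from (step-spec Htilde G x y) (case edge? k (toℕ x) (toℕ y) of λ where
    (yes e) → inj₁ (fromWitness e)
    (no ¬e) → let (φ , emb , ¬old) = new-embedding (toWitness t) ¬e in
              inj₂ (x≢y (toWitness t) , copies-increase Htilde-automorphisms Htilde-selfEmbeddings
                                          {G = G} {G′ = addEdge G x y} (addEdge-⊇ G x y) φ emb ¬old))

-- The H̃-process on T_5

process-lollipop : ∀ n i → process Htilde (lollipop n 5) i ≐ lollipop n (5 + i * 2)
process-lollipop n zero    x y = refl
process-lollipop n (suc i) x y =
  trans (step-cong Htilde {process Htilde (lollipop n 5) i} {lollipop n (5 + i * 2)} (process-lollipop n i) x y)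
        (step-lollipop n (5 + i * 2) (ℕ.m≤m+n 4 (1 + i * 2)) x y)

lollipop-stable⇔ : ∀ n m → (lollipop n (2 + m) ≐ lollipop n (4 + m)) ⇔ n ≤ 3 + m
lollipop-stable⇔ n m = mk⇔ stable⇒covered covered⇒stable
  where
  covered⇒stable : n ≤ 3 + m → lollipop n (2 + m) ≐ lollipop n (4 + m)
  covered⇒stable n≤3+m x y = T-injective (mk⇔
    (fromWitness ∘ Edge-mono (ℕ.m≤n+m (2 + m) 2) ∘ toWitness)
    (λ t → fromWitness (inj₁ (in-block x , in-block y , Edge-parity (toWitness t)))))
    where
    in-block : ∀ u → toℕ u ≤ 2 + m
    in-block u = ℕ.≤-pred (ℕ.<-≤-trans (toℕ<n u) n≤3+m)
  far : Edge (4 + m) (3 + m) m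
  far = inj₁ (ℕ.n≤1+n _ , ℕ.m≤n+m m 4 , parity-3+ m)
  not-near : ¬ Edge (2 + m) (3 + m) m
  not-near (inj₁ (3+m≤2+m , _))  = ℕ.1+n≰n 3+m≤2+m
  not-near (inj₂ (inj₁ 4+m≡m))   = ℕ.m≢1+n+m m (sym 4+m≡m)
  not-near (inj₂ (inj₂ 1+m≡3+m)) = ℕ.m≢1+n+m m (ℕ.suc-injective 1+m≡3+m)
  stable⇒covered : lollipop n (2 + m) ≐ lollipop n (4 + m) → n ≤ 3 + m
  stable⇒covered same = decidable-stable (n ≤? 3 + m) (not-near ∘ near ∘ ℕ.≰⇒>)
    where
    near : 3 + m < n → Edge (2 + m) (3 + m) m
    near 3+m<n = subst₂ (Edge (2 + m)) (toℕ-fromℕ< 3+m<n) (toℕ-fromℕ< m<n)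
                   (toWitness (subst T (sym (same u v)) (fromWitness far′)))
      where
      m<n : m < n
      m<n = ℕ.≤-<-trans (ℕ.m≤n+m m 3) 3+m<n
      u v : Fin n
      u = fromℕ< 3+m<n
      v = fromℕ< m<n
      far′ : Edge (4 + m) (toℕ u) (toℕ v)
      far′ = subst₂ (Edge (4 + m)) (sym (toℕ-fromℕ< 3+m<n)) (sym (toℕ-fromℕ< m<n)) far

Stable-lollipop⇔ : ∀ n t → Stable Htilde (lollipop n 5) t ⇔ n ≤ 6 + t * 2
Stable-lollipop⇔ n t = mk⇔
  (to (lollipop-stable⇔ n (3 + t * 2)) ∘ λ stable x y →
    trans (sym (process-lollipop n t x y)) (trans (stable x y) (process-lollipop n (suc t) x y)))
  ((λ same x y → trans (process-lollipop n t x y) (trans (same x y) (sym (process-lollipop n (suc t) x y))))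
    ∘ from (lollipop-stable⇔ n (3 + t * 2)))

m≤⌈m/2⌉*2 : ∀ m → m ≤ ⌈ m /2⌉ * 2
m≤⌈m/2⌉*2 zero          = z≤n
m≤⌈m/2⌉*2 (suc zero)    = s≤s z≤n
m≤⌈m/2⌉*2 (suc (suc m)) = s≤s (s≤s (m≤⌈m/2⌉*2 m))

m≤n*2⇒⌈m/2⌉≤n : ∀ m n → m ≤ n * 2 → ⌈ m /2⌉ ≤ n
m≤n*2⇒⌈m/2⌉≤n zero          n       _                    = z≤n
m≤n*2⇒⌈m/2⌉≤n (suc zero)    (suc n) _                    = s≤s z≤n
m≤n*2⇒⌈m/2⌉≤n (suc (suc m)) (suc n) (s≤s (s≤s m≤n*2)) = s≤s (m≤n*2⇒⌈m/2⌉≤n m n m≤n*2)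

n≤6+⌈[n∸6]/2⌉*2 : ∀ n → n ≤ 6 + ⌈ (n ∸ 6) /2⌉ * 2
n≤6+⌈[n∸6]/2⌉*2 n = ℕ.≤-trans (ℕ.m≤n+m∸n n 6) (ℕ.+-monoʳ-≤ 6 (m≤⌈m/2⌉*2 (n ∸ 6)))

running-time : ∀ n → IsRunningTime Htilde (lollipop n 5) ⌈ (n ∸ 6) /2⌉
running-time n = from (Stable-lollipop⇔ n ⌈ (n ∸ 6) /2⌉) (n≤6+⌈[n∸6]/2⌉*2 n)
               , λ s stable → m≤n*2⇒⌈m/2⌉≤n (n ∸ 6) s (ℕ.m≤n+o⇒m∸n≤o n 6 (to (Stable-lollipop⇔ n s) stable))

running-time-linear : ∀ n → 12 ≤ n → 1 * n ≤ 4 * ⌈ (n ∸ 6) /2⌉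
running-time-linear n 12≤n = begin
  1 * n          ≡⟨ ℕ.*-identityˡ n ⟩
  n              ≤⟨ n≤6+⌈[n∸6]/2⌉*2 n ⟩
  6 + τ * 2      ≤⟨ ℕ.+-monoˡ-≤ (τ * 2) (ℕ.≤-trans (ℕ.∸-monoˡ-≤ 6 12≤n) (m≤⌈m/2⌉*2 (n ∸ 6))) ⟩
  τ * 2 + τ * 2  ≡⟨ trans (sym (ℕ.*-distribˡ-+ τ 2 2)) (ℕ.*-comm τ 4) ⟩
  4 * τ          ∎
  where
  open ℕ.≤-Reasoning
  τ : ℕ
  τ = ⌈ (n ∸ 6) /2⌉

lollipop-simple : ∀ n k → IsSimple (lollipop n k)
lollipop-simple n k = symmetric , irreflexive
  where
  symmetric : ∀ x y → lollipop n k x y ≡ lollipop n k y x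
  symmetric x y = T-injective (mk⇔ (fromWitness ∘ Edge-sym ∘ toWitness) (fromWitness ∘ Edge-sym ∘ toWitness))
  irreflexive : ∀ x → lollipop n k x x ≡ false
  irreflexive x with edge? k (toℕ x) (toℕ x)
  ... | yes e = contradiction e Edge-irrefl
  ... | no _  = refl

isOdd : Parity → Bool
isOdd 0ℙ = false
isOdd 1ℙ = true

isOdd-injective : Injective _≡_ _≡_ isOdd
isOdd-injective {0ℙ} {0ℙ} _ = refl
isOdd-injective {1ℙ} {1ℙ} _ = refl

process-bipartite : ∀ n i → Bipartite (process Htilde (lollipop n 5) i)
process-bipartite n i = isOdd ∘ parity ∘ toℕ , λ x y xy →
  Edge-parity (toWitness (subst T (process-lollipop n i x y) (from T-≡ xy))) ∘ isOdd-injective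

mainTheorem10 : Σ ℕ λ a → Σ ℕ λ b → Σ ℕ λ N → (n : ℕ) → N ≤ n → Σ (Graph n) λ G → IsSimple G × (Σ ℕ λ τ → IsRunningTime Htilde G τ × (suc a * n ≤ suc b * τ)) × ((i : ℕ) → Bipartite (process Htilde G i))
mainTheorem10 = 0 , 3 , 12 , λ n 12≤n →
    lollipop n 5
  , lollipop-simple n 5
  , (⌈ (n ∸ 6) /2⌉ , running-time n , running-time-linear n 12≤n)
  , process-bipartite n
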